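{- For each positive integer $k$, \[ V_k:=\sum_{i=1}^{k}\left[(-1)^{i-1}\binom{k+1}{i} i^k + (-1)^k\binom{k}{i}k^i\right] = (-1)^{k+1}. \] -}

module Defs where

open import Data.Nat as ℕ using (ℕ; zero; suc)
open import Data.Nat.Combinatorics using (_C_)
open import Data.Integer using (ℤ; +_; -_; _+_; _*_; 0ℤ; 1ℤ)

sgn : ℕ → ℤ
sgn zero    = 1ℤ
sgn (suc n) = - sgn n

sumFrom1 : ℕ → (ℕ → ℤ) → ℤ
sumFrom1 zero    f = 0ℤ
sumFrom1 (suc k) f = sumFrom1 k f + f (suc k)

V : ℕ → ℤ
V k = sumFrom1 k (λ i → sgn (i ℕ.∸ 1) * + ((suc k C i) ℕ.* (i ℕ.^ k))
                      + sgn k * + ((k C i) ℕ.* (k ℕ.^ i)))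

module Submission where

-- Proof idea.  Write P = (k+1)^k.  The two halves of V_k are evaluated separately.
--
-- * Alternating half.  For any f : ℕ → ℤ,
--     Σ_{i=0}^{n} (-1)^i C(n,i) f(i) = (-1)^n (Δⁿ f)(0),
--   where Δ f (i) = f (i+1) - f i is the forward difference.  The power
--   i ↦ i^k is killed by Δ^{k+1} (difference operators lower degree), so the
--   full alternating sum with n = k+1 vanishes.  Splitting off the terms
--   i = 0 (equal to 0^k = 0) and i = k+1 (equal to (-1)^{k+1} P) gives
--     Σ_{i=1}^{k} (-1)^{i-1} C(k+1,i) i^k = (-1)^{k+1} P.
-- * Binomial half.  The binomial theorem gives Σ_{i=1}^{k} C(k,i) k^i = P - 1.
--
-- Hence V_k = (-1)^{k+1} P + (-1)^k (P - 1) = (-1)^{k+1}.  Both halves rest on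
-- Pascal's rule for binomially weighted sums, proved first together with the
-- basic linearity of finite sums.

open import Defs
open import Data.Nat using (ℕ; suc; _≤_)
open import Relation.Binary.PropositionalEquality using (_≡_)
open import Data.Integer using (ℤ)

open import Data.Nat as ℕ using (zero; s≤s; z≤n; _^_)
open import Data.Nat.Properties using (n<1+n)
open import Data.Nat.Combinatorics using (_C_; nCn≡1; nCk+nC[k+1]≡[n+1]C[k+1])
open import Data.Nat.Combinatorics.Specification using (k>n⇒nCk≡0)
open import Data.Integer using (+_; -_; _+_; _*_; _-_; 0ℤ; 1ℤ)
open import Data.Integer.Properties
  using (pos-*; pos-+; +-assoc; +-identityˡ; +-identityʳ; *-identityˡ; *-zeroʳ;
         *-distribˡ-+; neg-distrib-+; neg-distribˡ-*; neg-distribʳ-*; i-j≡0⇒i≡j)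
open import Data.Integer.Tactic.RingSolver using (solve-∀)
open import Relation.Binary.PropositionalEquality
  using (refl; sym; trans; cong; cong₂; module ≡-Reasoning)
open import Function using (_∘_)

open ≡-Reasoning

sumBelow : ℕ → (ℕ → ℤ) → ℤ
sumBelow zero    f = 0ℤ
sumBelow (suc n) f = sumBelow n f + f n

sumFrom1≡sumBelow : ∀ n f → sumFrom1 n f ≡ sumBelow n (f ∘ suc)
sumFrom1≡sumBelow zero    f = refl
sumFrom1≡sumBelow (suc n) f = cong (_+ f (suc n)) (sumFrom1≡sumBelow n f)

sumBelow-cong : ∀ n {f g : ℕ → ℤ} → (∀ i → f i ≡ g i) → sumBelow n f ≡ sumBelow n g
sumBelow-cong zero    f≡g = refl
sumBelow-cong (suc n) f≡g = cong₂ _+_ (sumBelow-cong n f≡g) (f≡g n)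

sumBelow-peel : ∀ n f → sumBelow (suc n) f ≡ f 0 + sumBelow n (f ∘ suc)
sumBelow-peel zero    f = trans (+-identityˡ (f 0)) (sym (+-identityʳ (f 0)))
sumBelow-peel (suc n) f = begin
  sumBelow (suc n) f + f (suc n)               ≡⟨ cong (_+ f (suc n)) (sumBelow-peel n f) ⟩
  f 0 + sumBelow n (f ∘ suc) + f (suc n)       ≡⟨ +-assoc (f 0) _ _ ⟩
  f 0 + (sumBelow n (f ∘ suc) + f (suc n))     ∎

sumBelow-+ : ∀ n (f g : ℕ → ℤ) → sumBelow n (λ i → f i + g i) ≡ sumBelow n f + sumBelow n g
sumBelow-+ zero    f g = refl
sumBelow-+ (suc n) f g = trans (cong (_+ (f n + g n)) (sumBelow-+ n f g))
                               (interchange (sumBelow n f) (sumBelow n g) (f n) (g n))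
  where
  interchange : ∀ a b c d → a + b + (c + d) ≡ a + c + (b + d)
  interchange = solve-∀

sumBelow-neg : ∀ n (f : ℕ → ℤ) → sumBelow n (λ i → - f i) ≡ - sumBelow n f
sumBelow-neg zero    f = refl
sumBelow-neg (suc n) f = trans (cong (_+ (- f n)) (sumBelow-neg n f))
                               (sym (neg-distrib-+ (sumBelow n f) (f n)))

sumBelow-scale : ∀ n c (f : ℕ → ℤ) → sumBelow n (λ i → c * f i) ≡ c * sumBelow n f
sumBelow-scale zero    c f = sym (*-zeroʳ c)
sumBelow-scale (suc n) c f = trans (cong (_+ (c * f n)) (sumBelow-scale n c f))
                                   (sym (*-distribˡ-+ c (sumBelow n f) (f n)))

binomialSum : ℕ → (ℕ → ℤ) → ℤ
binomialSum n g = sumBelow (suc n) (λ i → + (n C i) * g i)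

binomialSum-+ : ∀ n (g h : ℕ → ℤ) → binomialSum n (λ i → g i + h i) ≡ binomialSum n g + binomialSum n h
binomialSum-+ n g h = trans (sumBelow-cong (suc n) (λ i → *-distribˡ-+ (+ (n C i)) (g i) (h i)))
                            (sumBelow-+ (suc n) _ _)

binomialSum-neg : ∀ n (g : ℕ → ℤ) → binomialSum n (λ i → - g i) ≡ - binomialSum n g
binomialSum-neg n g = trans (sumBelow-cong (suc n) (λ i → sym (neg-distribʳ-* (+ (n C i)) (g i))))
                            (sumBelow-neg (suc n) _)

binomialSum-scale : ∀ n c (g : ℕ → ℤ) → binomialSum n (λ i → c * g i) ≡ c * binomialSum n g
binomialSum-scale n c g = trans (sumBelow-cong (suc n) (λ i → swap (+ (n C i)) c (g i)))
                                (sumBelow-scale (suc n) c _)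
  where
  swap : ∀ a b x → a * (b * x) ≡ b * (a * x)
  swap = solve-∀

-- Pascal's rule C(n+1,i+1) = C(n,i) + C(n,i+1), summed against g:
-- the weights of level n+1 split into those of level n at g and at g shifted.
binomialSum-pascal : ∀ n g → binomialSum (suc n) g ≡ binomialSum n g + binomialSum n (g ∘ suc)
binomialSum-pascal n g = begin
  binomialSum (suc n) g
    ≡⟨ sumBelow-peel (suc n) _ ⟩
  g₀ + sumBelow (suc n) (λ i → + (suc n C suc i) * g (suc i))
    ≡⟨ cong (_+_ g₀) (sumBelow-cong (suc n) splitWeight) ⟩
  g₀ + sumBelow (suc n) (λ i → + (n C i) * g (suc i) + + (n C suc i) * g (suc i))
    ≡⟨ cong (_+_ g₀) (sumBelow-+ (suc n) _ _) ⟩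
  g₀ + (binomialSum n (g ∘ suc) + upper)
    ≡⟨ rearrange g₀ (binomialSum n (g ∘ suc)) upper ⟩
  g₀ + upper + binomialSum n (g ∘ suc)
    ≡⟨ cong (_+ binomialSum n (g ∘ suc)) lowerWeights ⟩
  binomialSum n g + binomialSum n (g ∘ suc) ∎
  where
  g₀ : ℤ
  g₀ = + 1 * g 0
  upper : ℤ
  upper = sumBelow (suc n) (λ i → + (n C suc i) * g (suc i))

  splitWeight : ∀ i → + (suc n C suc i) * g (suc i) ≡ + (n C i) * g (suc i) + + (n C suc i) * g (suc i)
  splitWeight i = begin
    + (suc n C suc i) * g (suc i)              ≡⟨ cong (λ c → + c * g (suc i)) (sym (nCk+nC[k+1]≡[n+1]C[k+1] n i)) ⟩
    + (n C i ℕ.+ n C suc i) * g (suc i)        ≡⟨ cong (_* g (suc i)) (pos-+ (n C i) (n C suc i)) ⟩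
    (+ (n C i) + + (n C suc i)) * g (suc i)    ≡⟨ distribʳ (+ (n C i)) (+ (n C suc i)) (g (suc i)) ⟩
    + (n C i) * g (suc i) + + (n C suc i) * g (suc i) ∎
    where
    distribʳ : ∀ a b x → (a + b) * x ≡ a * x + b * x
    distribʳ = solve-∀

  -- The shifted level-n weights, completed by the i = 0 term, are the level-n
  -- weights; the would-be top term carries C(n,n+1) = 0.
  lowerWeights : g₀ + upper ≡ binomialSum n g
  lowerWeights = begin
    g₀ + upper                                                  ≡⟨ sym (sumBelow-peel (suc n) _) ⟩
    binomialSum n g + + (n C suc n) * g (suc n)                 ≡⟨ cong (λ c → binomialSum n g + + c * g (suc n)) (k>n⇒nCk≡0 (n<1+n n)) ⟩
    binomialSum n g + 0ℤ                                        ≡⟨ +-identityʳ _ ⟩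
    binomialSum n g                                             ∎

  rearrange : ∀ a b c → a + (b + c) ≡ a + c + b
  rearrange = solve-∀

binomialTheorem : ∀ n x → binomialSum n (λ i → + (x ^ i)) ≡ + (suc x ^ n)
binomialTheorem zero    x = refl
binomialTheorem (suc n) x = begin
  binomialSum (suc n) (λ i → + (x ^ i))
    ≡⟨ binomialSum-pascal n _ ⟩
  S + binomialSum n (λ i → + (x ^ suc i))
    ≡⟨ cong (_+_ S) (trans (sumBelow-cong (suc n) (λ i → cong (+ (n C i) *_) (pos-* x (x ^ i))))
                          (binomialSum-scale n (+ x) _)) ⟩
  S + + x * S
    ≡⟨ cong (λ s → s + + x * s) (binomialTheorem n x) ⟩
  + P + + x * + P
    ≡⟨ sym (trans (pos-+ P (x ℕ.* P)) (cong (_+_ (+ P)) (pos-* x P))) ⟩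
  + (suc x ^ suc n) ∎
  where
  S : ℤ
  S = binomialSum n (λ i → + (x ^ i))
  P : ℕ
  P = suc x ^ n

binomialTail : ∀ n x → sumBelow n (λ j → + ((n C suc j) ℕ.* (x ^ suc j))) ≡ + (suc x ^ n) - 1ℤ
binomialTail n x = begin
  T                 ≡⟨ addSubOne T ⟩
  1ℤ + T - 1ℤ       ≡⟨ cong (λ t → 1ℤ + t - 1ℤ) (sumBelow-cong n (λ j → pos-* (n C suc j) (x ^ suc j))) ⟩
  1ℤ + sumBelow n (λ j → + (n C suc j) * + (x ^ suc j)) - 1ℤ
                    ≡˘⟨ cong (_- 1ℤ) (sumBelow-peel n _) ⟩
  binomialSum n (λ i → + (x ^ i)) - 1ℤ
                    ≡⟨ cong (_- 1ℤ) (binomialTheorem n x) ⟩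
  + (suc x ^ n) - 1ℤ ∎
  where
  T : ℤ
  T = sumBelow n (λ j → + ((n C suc j) ℕ.* (x ^ suc j)))
  addSubOne : ∀ t → t ≡ 1ℤ + t - 1ℤ
  addSubOne = solve-∀

Δ : (ℕ → ℤ) → ℕ → ℤ
Δ f i = f (suc i) - f i

Δ^ : ℕ → (ℕ → ℤ) → ℕ → ℤ
Δ^ zero    f = f
Δ^ (suc n) f = Δ^ n (Δ f)

Δ^-cong : ∀ n {f g : ℕ → ℤ} → (∀ i → f i ≡ g i) → ∀ i → Δ^ n f i ≡ Δ^ n g i
Δ^-cong zero    f≡g = f≡g
Δ^-cong (suc n) f≡g = Δ^-cong n (λ i → cong₂ _-_ (f≡g (suc i)) (f≡g i))

Δ^-+ : ∀ n (f g : ℕ → ℤ) i → Δ^ n (λ j → f j + g j) i ≡ Δ^ n f i + Δ^ n g i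
Δ^-+ zero    f g i = refl
Δ^-+ (suc n) f g i = trans (Δ^-cong n (λ j → Δ-+ (f (suc j)) (g (suc j)) (f j) (g j)) i)
                           (Δ^-+ n (Δ f) (Δ g) i)
  where
  Δ-+ : ∀ a b c d → (a + b) - (c + d) ≡ (a - c) + (b - d)
  Δ-+ = solve-∀

Δ^-shift : ∀ n f i → Δ^ n (f ∘ suc) i ≡ Δ^ n f (suc i)
Δ^-shift zero    f i = refl
Δ^-shift (suc n) f i = Δ^-shift n (Δ f) i

-- Discrete Leibniz rule: Δ(i·f(i)) = f(i+1) + i·Δf(i), iterated n times.
Δ^-leibniz : ∀ n f i → Δ^ (suc n) (λ j → + j * f j) i ≡ Δ^ n f (suc i) + Δ^ n (λ j → + j * Δ f j) i
Δ^-leibniz n f i = begin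
  Δ^ n (Δ (λ j → + j * f j)) i
    ≡⟨ Δ^-cong n (λ j → leibniz (+ j) (f j) (f (suc j))) i ⟩
  Δ^ n (λ j → f (suc j) + + j * Δ f j) i
    ≡⟨ Δ^-+ n (f ∘ suc) _ i ⟩
  Δ^ n (f ∘ suc) i + Δ^ n (λ j → + j * Δ f j) i
    ≡⟨ cong (_+ Δ^ n (λ j → + j * Δ f j) i) (Δ^-shift n f i) ⟩
  Δ^ n f (suc i) + Δ^ n (λ j → + j * Δ f j) i ∎
  where
  leibniz : ∀ a x y → (1ℤ + a) * y - a * x ≡ y + a * (y - x)
  leibniz = solve-∀

DegreeBelow : ℕ → (ℕ → ℤ) → Set
DegreeBelow n f = ∀ i → Δ^ n f i ≡ 0ℤ

DegreeBelow-cong : ∀ n {f g : ℕ → ℤ} → (∀ i → f i ≡ g i) → DegreeBelow n f → DegreeBelow n g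
DegreeBelow-cong n f≡g deg i = trans (sym (Δ^-cong n f≡g i)) (deg i)

DegreeBelow-*id : ∀ n f → DegreeBelow n f → DegreeBelow (suc n) (λ i → + i * f i)
DegreeBelow-*id zero f deg i =
  trans (Δ^-leibniz zero f i)
        (cong₂ _+_ (deg (suc i)) (trans (cong (+ i *_) (cong₂ _-_ (deg (suc i)) (deg i))) (*-zeroʳ (+ i))))
DegreeBelow-*id (suc n) f deg i =
  trans (Δ^-leibniz (suc n) f i) (cong₂ _+_ (deg (suc i)) (DegreeBelow-*id n (Δ f) deg i))

DegreeBelow-power : ∀ k → DegreeBelow (suc k) (λ i → + (i ^ k))
DegreeBelow-power zero    i = refl
DegreeBelow-power (suc k) =
  DegreeBelow-cong (suc (suc k)) (λ i → sym (pos-* i (i ^ k)))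
                   (DegreeBelow-*id (suc k) (λ i → + (i ^ k)) (DegreeBelow-power k))

alternatingSum : ℕ → (ℕ → ℤ) → ℤ
alternatingSum n f = binomialSum n (λ i → sgn i * f i)

alternatingSum-Δ : ∀ n f → alternatingSum (suc n) f ≡ - alternatingSum n (Δ f)
alternatingSum-Δ n f = begin
  alternatingSum (suc n) f
    ≡⟨ binomialSum-pascal n _ ⟩
  alternatingSum n f + binomialSum n (λ i → - sgn i * f (suc i))
    ≡⟨ cong (_+_ (alternatingSum n f)) (trans (sumBelow-cong (suc n) (λ i → cong (+ (n C i) *_) (sym (neg-distribˡ-* (sgn i) (f (suc i))))))
                                           (binomialSum-neg n _)) ⟩
  alternatingSum n f + - alternatingSum n (f ∘ suc)
    ≡⟨ negateDifference (alternatingSum n f) (alternatingSum n (f ∘ suc)) ⟩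
  - (alternatingSum n (f ∘ suc) + - alternatingSum n f)
    ≡⟨ cong -_ (sym differenceSplit) ⟩
  - alternatingSum n (Δ f) ∎
  where
  negateDifference : ∀ a b → a + - b ≡ - (b + - a)
  negateDifference = solve-∀

  differenceSplit : alternatingSum n (Δ f) ≡ alternatingSum n (f ∘ suc) + - alternatingSum n f
  differenceSplit = begin
    alternatingSum n (Δ f)
      ≡⟨ sumBelow-cong (suc n) (λ i → cong (+ (n C i) *_) (distrib (sgn i) (f (suc i)) (f i))) ⟩
    binomialSum n (λ i → sgn i * f (suc i) + - (sgn i * f i))
      ≡⟨ binomialSum-+ n _ _ ⟩
    alternatingSum n (f ∘ suc) + binomialSum n (λ i → - (sgn i * f i))
      ≡⟨ cong (_+_ (alternatingSum n (f ∘ suc))) (binomialSum-neg n _) ⟩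
    alternatingSum n (f ∘ suc) + - alternatingSum n f ∎
    where
    distrib : ∀ s a b → s * (a - b) ≡ s * a + - (s * b)
    distrib = solve-∀

alternatingSum≡Δ^ : ∀ n f → alternatingSum n f ≡ sgn n * Δ^ n f 0
alternatingSum≡Δ^ zero    f = trans (+-identityˡ _) (*-identityˡ (1ℤ * f 0))
alternatingSum≡Δ^ (suc n) f = begin
  alternatingSum (suc n) f       ≡⟨ alternatingSum-Δ n f ⟩
  - alternatingSum n (Δ f)       ≡⟨ cong -_ (alternatingSum≡Δ^ n (Δ f)) ⟩
  - (sgn n * Δ^ n (Δ f) 0)       ≡⟨ neg-distribˡ-* (sgn n) _ ⟩
  sgn (suc n) * Δ^ (suc n) f 0   ∎

alternatingSum-ends : ∀ n f → alternatingSum (suc n) f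
  ≡ f 0 + - sumBelow n (λ j → sgn j * (+ (suc n C suc j) * f (suc j))) + sgn (suc n) * f (suc n)
alternatingSum-ends n f = cong₂ _+_
  (trans (sumBelow-peel n _)
         (cong₂ _+_ (trans (*-identityˡ (1ℤ * f 0)) (*-identityˡ (f 0)))
                    (trans (sumBelow-cong n (λ j → negateSign (+ (suc n C suc j)) (sgn j) (f (suc j))))
                           (sumBelow-neg n _))))
  (trans (cong (λ c → + c * (sgn (suc n) * f (suc n))) (nCn≡1 (suc n))) (*-identityˡ _))
  where
  negateSign : ∀ c s x → c * (- s * x) ≡ - (s * (c * x))
  negateSign = solve-∀

-- The alternating half of V_k: Σ_{i=1}^{k} (-1)^{i-1} C(k+1,i) i^k = (-1)^{k+1} (k+1)^k
-- for k ≥ 1, since the full alternating sum of the degree-k power vanishes.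
signedPowerSum : ∀ m → let k = suc m in
  sumBelow k (λ j → sgn j * + ((suc k C suc j) ℕ.* (suc j ^ k))) ≡ sgn (suc k) * + (suc k ^ k)
signedPowerSum m = sym (i-j≡0⇒i≡j Q S (begin
  Q - S                                                       ≡⟨ reorder S Q ⟩
  0ℤ + - S + Q                                                ≡⟨ cong (λ s → 0ℤ + - s + Q) (sumBelow-cong k (λ j → cong (sgn j *_) (pos-* (suc k C suc j) (suc j ^ k)))) ⟩
  0ℤ + - sumBelow k (λ j → sgn j * (+ (suc k C suc j) * + (suc j ^ k))) + Q
                                                              ≡˘⟨ alternatingSum-ends k _ ⟩
  alternatingSum (suc k) (λ i → + (i ^ k))                    ≡⟨ alternatingSum≡Δ^ (suc k) _ ⟩
  sgn (suc k) * Δ^ (suc k) (λ i → + (i ^ k)) 0               ≡⟨ cong (sgn (suc k) *_) (DegreeBelow-power k 0) ⟩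
  sgn (suc k) * 0ℤ                                            ≡⟨ *-zeroʳ (sgn (suc k)) ⟩
  0ℤ                                                          ∎))
  where
  k : ℕ
  k = suc m
  S : ℤ
  S = sumBelow k (λ j → sgn j * + ((suc k C suc j) ℕ.* (suc j ^ k)))
  Q : ℤ
  Q = sgn (suc k) * + (suc k ^ k)
  reorder : ∀ s q → q - s ≡ 0ℤ + - s + q
  reorder = solve-∀

mainTheorem2 : (k : ℕ) → 1 ≤ k → V k ≡ sgn (suc k)
mainTheorem2 (suc m) (s≤s z≤n) = begin
  V k
    ≡⟨ sumFrom1≡sumBelow k _ ⟩
  sumBelow k (λ j → a j + sgn k * b j)
    ≡⟨ sumBelow-+ k a _ ⟩
  sumBelow k a + sumBelow k (λ j → sgn k * b j)
    ≡⟨ cong₂ _+_ (signedPowerSum m) (trans (sumBelow-scale k (sgn k) b) (cong (sgn k *_) (binomialTail k k))) ⟩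
  sgn (suc k) * + P + sgn k * (+ P - 1ℤ)
    ≡⟨ cancel (sgn k) (+ P) ⟩
  sgn (suc k) ∎
  where
  k : ℕ
  k = suc m
  P : ℕ
  P = suc k ^ k
  a b : ℕ → ℤ
  a j = sgn j * + ((suc k C suc j) ℕ.* (suc j ^ k))
  b j = + ((k C suc j) ℕ.* (k ^ suc j))
  cancel : ∀ s p → - s * p + s * (p - 1ℤ) ≡ - s
  cancel = solve-∀
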